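{- Let $\mathsf M$ be a matroid on $[n]$, $\Bbbk$ a field, and $X$ a flat of $\mathsf M$. For any $v\in V(\mathsf M_X)$, the complex $(A(\mathsf M_X),\cdot v)$ is (via the map induced by the inclusion $X\subseteq[n]$) a split subcomplex of $(A(\mathsf M),\cdot v)$, i.e. a subcomplex that is a direct summand as a cochain complex.
   Context: For a matroid $\mathsf N$ on a finite set $S$: $V(\mathsf N)=\Bbbk^S$ with basis $\{e_s\}$, $E=\Lambda(V(\mathsf N))$, $\partial$ the graded derivation with $\partial(e_s)=1$, $e_C=\prod_{s\in C}e_s$; $A(\mathsf N)=E/I$ with $I$ generated by $\partial(e_C)$ over circuits $C$ of $\mathsf N$. For $v\in V(\mathsf N)$, $(A(\mathsf N),\cdot v)$ is the cochain complex with differential $x\mapsto xv$. $\mathsf M_X$ denotes the restriction of $\mathsf M$ to $X$ (a matroid on $X$), and $V(\mathsf M_X)=\Bbbk^X$ is identified with the coordinate subspace of $\Bbbk^n$ supported on $X$. -}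

module Defs where

open import Level using (Level; _⊔_) renaming (suc to lsuc; zero to lzero)
open import Algebra.Bundles using (CommutativeRing)
open import Data.Nat as ℕ using (ℕ; zero; suc; _<_; _≤_; _<ᵇ_; _≡ᵇ_)
open import Data.Fin as Fin using (Fin; toℕ)
open import Data.Fin.Subset using (Subset; ⊥; ⊤; ⁅_⁆; _∈_; _∉_; _⊆_; _⊂_; _∪_; _─_; ∣_∣)
open import Data.Fin.Subset.Properties using (_⊆?_)
open import Data.Bool as B using (Bool; true; false; if_then_else_; _∧_)
open import Data.List using (List; []; _∷_; map; foldr; _++_; concatMap; allFin)
open import Data.List.Relation.Unary.All using (All)
open import Data.Vec using ([]; _∷_; lookup)
open import Data.Vec.Properties using (≡-dec)
open import Data.Product using (Σ; ∃; _×_; _,_)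
open import Relation.Nullary using (¬_; does)
open import Relation.Binary.PropositionalEquality using (_≡_)

record Field c ℓ : Set (lsuc (c ⊔ ℓ)) where
  field
    commutativeRing : CommutativeRing c ℓ
  open CommutativeRing commutativeRing public
  field
    1≉0     : ¬ (1# ≈ 0#)
    inverse : ∀ x → ¬ (x ≈ 0#) → ∃ λ y → x * y ≈ 1#

record Matroid (n : ℕ) : Set₁ where
  field
    Indep     : Subset n → Set
    indep-⊥   : Indep ⊥
    indep-⊆   : ∀ {I J} → I ⊆ J → Indep J → Indep I
    indep-aug : ∀ {I J} → Indep I → Indep J → ∣ I ∣ < ∣ J ∣ →
                ∃ λ e → e ∈ J × e ∉ I × Indep (I ∪ ⁅ e ⁆)

module _ {n : ℕ} (M : Matroid n) where
  open Matroid M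

  HasRank : Subset n → ℕ → Set
  HasRank Y k = (∃ λ I → I ⊆ Y × Indep I × ∣ I ∣ ≡ k)
              × (∀ J → J ⊆ Y → Indep J → ∣ J ∣ ≤ k)

  IsFlat : Subset n → Set
  IsFlat X = ∀ e → e ∉ X → ∀ k k' → HasRank X k → HasRank (X ∪ ⁅ e ⁆) k' → k < k'

  RestrictIndep : Subset n → Subset n → Set
  RestrictIndep X I = I ⊆ X × Indep I

IsCircuitIn : {n : ℕ} → Subset n → (Subset n → Set) → Subset n → Set
IsCircuitIn G Ind C = C ⊆ G × ¬ Ind C × (∀ D → D ⊂ C → Ind D)

-- Exterior algebra Λ(𝕜^n): an element is its coefficient function on the
-- basis {e_T : T ⊆ [n]},  e_T = e_{t₁} ⋯ e_{t_k} with t₁ < ⋯ < t_k.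

subsets : (m : ℕ) → List (Subset m)
subsets zero    = [] ∷ []
subsets (suc m) = map (true ∷_) (subsets m) ++ map (false ∷_) (subsets m)

countB : List Bool → ℕ
countB = foldr (λ b k → if b then suc k else k) 0

module Exterior {c ℓ} (F : Field c ℓ) (n : ℕ) where
  open Field F

  Λ : Set c
  Λ = Subset n → Carrier

  infix 4 _≋_
  _≋_ : Λ → Λ → Set ℓ
  x ≋ y = ∀ T → x T ≈ y T

  sumK : List Carrier → Carrier
  sumK = foldr _+_ 0#

  0Λ : Λ
  0Λ T = 0#

  infixl 6 _+Λ_ _-Λ_
  _+Λ_ : Λ → Λ → Λ
  (x +Λ y) T = x T + y T

  _-Λ_ : Λ → Λ → Λ
  (x -Λ y) T = x T + (- y T)

  infixr 7 _•_
  _•_ : Carrier → Λ → Λ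
  (a • x) T = a * x T

  sumΛ : List Λ → Λ
  sumΛ = foldr _+Λ_ 0Λ

  sgn : ℕ → Carrier
  sgn zero    = 1#
  sgn (suc k) = - sgn k

  mem : Subset n → Fin n → Bool
  mem T i = lookup T i

  e : Subset n → Λ
  e T U = if does (≡-dec B._≟_ U T) then 1# else 0#

  inv : Subset n → Subset n → ℕ
  inv T U = countB (concatMap (λ t → map (λ u → mem T t ∧ mem U u ∧ (toℕ u <ᵇ toℕ t)) (allFin n)) (allFin n))

  -- exterior product:  e_T e_U = (-1)^{inv T U} e_{T ∪ U} if T ∩ U = ∅, and 0 otherwise
  infixl 7 _∧Λ_
  _∧Λ_ : Λ → Λ → Λ
  (x ∧Λ y) W = sumK (map (λ T → if does (T ⊆? W)
                                  then sgn (inv T (W ─ T)) * (x T * y (W ─ T))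
                                  else 0#) (subsets n))

  -- the graded derivation ∂ with ∂ e_s = 1:
  -- ∂ e_T = Σ_i (-1)^{i-1} e_{T ∖ t_i}
  ∂ : Λ → Λ
  ∂ x W = sumK (map (λ t → if mem W t then 0#
                           else sgn (countB (map (λ s → mem W s ∧ (toℕ s <ᵇ toℕ t)) (allFin n)))
                                * x (W ∪ ⁅ t ⁆)) (allFin n))

  embedV : (Fin n → Carrier) → Λ
  embedV v = sumΛ (map (λ i → v i • e ⁅ i ⁆) (allFin n))

  proj : ℕ → Λ → Λ
  proj p x T = if ∣ T ∣ ≡ᵇ p then x T else 0#

  -- x lies in Λ(𝕜^G) ⊆ Λ(𝕜^n)
  SupportedIn : Subset n → Λ → Set ℓ
  SupportedIn G x = ∀ T → ¬ (T ⊆ G) → x T ≈ 0#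

  -- the ideal I ⊆ Λ(𝕜^G) generated by ∂ e_C, C a circuit of the matroid (G, Ind):
  -- x ∈ I iff x = Σ a_j (∂ e_{C_j}) b_j with a_j, b_j ∈ Λ(𝕜^G)
  InIdeal : Subset n → (Subset n → Set) → Λ → Set (c ⊔ ℓ)
  InIdeal G Ind x =
    Σ (List (Λ × Subset n × Λ)) λ gs →
      All (λ { (a , C , b) → SupportedIn G a × SupportedIn G b × IsCircuitIn G Ind C }) gs
      × (x ≋ sumΛ (map (λ { (a , C , b) → a ∧Λ ∂ (e C) ∧Λ b }) gs))

  -- equality in the Orlik–Solomon-type algebra A = Λ(𝕜^G) / I
  ≈A[_,_] : Subset n → (Subset n → Set) → Λ → Λ → Set (c ⊔ ℓ)
  ≈A[ G , Ind ] x y = InIdeal G Ind (x -Λ y)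

-- π = restriction of coefficients to subsets of X is multiplicative, commutes with
-- ·v because v is supported in X, and is the identity on Λ(𝕜^X); what remains is
-- that π maps the ideal of M into that of M_X. Circuits inside X are circuits of
-- M_X. For a circuit C ⊄ X, a term e_{C∖c} of ∂ e_C with C ∖ c ⊆ X has c ∉ X; then
-- C ∖ c is independent in the flat X, and a basis I ⊇ C ∖ c of X has I ∪ c ⊇ C
-- dependent, so rank (X ∪ c) = ∣ I ∣ = rank X, contradicting flatness. Hence
-- π ∂ e_C = 0.
module Submission where

open import Defs
open import Data.Nat using (ℕ)
open import Data.Fin using (Fin)
open import Data.Fin.Subset using (Subset; ⊤; _∉_)
open import Data.Product using (Σ; _×_)

open import Data.Nat as ℕ using (zero; suc; _≤_; _≤?_)
open import Data.Nat.Properties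
  using (≰⇒>; <⇒≱; <-irrefl; ≤-trans; ≤-reflexive; +-suc; +-monoʳ-≤; m≤m+n)
open import Data.Fin.Subset using (_∈_; _⊆_; _⊂_; _∪_; _─_; ⁅_⁆; ∣_∣)
open import Data.Fin.Subset.Properties
  using (_∈?_; _⊆?_; ⊆-refl; ⊆-trans; ⊆⊤; p⊆p∪q; q⊆p∪q; x∈p∪q⁻; x∈p∪q⁺; x∈⁅x⁆; x∈⁅y⁆⇒x≡y;
         x∈p∧x∉q⇒x∈p─q; p─q⊆p; p⊂q⇒∣p∣<∣q∣; ∣p∣≤n)
open import Data.Vec using (lookup)
open import Data.Vec.Properties using ([]=⇒lookup; ≡-dec)
open import Data.Bool as B using (true; false; if_then_else_)
open import Data.List using (List; []; _∷_; map; allFin)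
open import Data.List.Relation.Unary.All using (All; []; _∷_)
import Data.List.Relation.Unary.All as All
open import Data.Product using (_,_; ∃; proj₁; proj₂)
open import Data.Sum using (_⊎_; inj₁; inj₂; [_,_]′)
open import Data.Empty using (⊥; ⊥-elim)
open import Function using (_∘_)
open import Relation.Nullary using (¬_; yes; no; does)
open import Relation.Binary.PropositionalEquality as ≡ using (_≡_; _≢_)

module _ {n : ℕ} where

  p⊂p∪⁅x⁆ : ∀ {p : Subset n} {x} → x ∉ p → p ⊂ p ∪ ⁅ x ⁆
  p⊂p∪⁅x⁆ {x = x} x∉p = p⊆p∪q ⁅ x ⁆ , x , x∈p∪q⁺ (inj₂ (x∈⁅x⁆ x)) , x∉p

  p∪⁅x⁆⊆r : ∀ {p r : Subset n} {x} → p ⊆ r → x ∈ r → p ∪ ⁅ x ⁆ ⊆ r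
  p∪⁅x⁆⊆r {p} {x = x} p⊆r x∈r y∈ with x∈p∪q⁻ p ⁅ x ⁆ y∈
  ... | inj₁ y∈p = p⊆r y∈p
  ... | inj₂ y∈⁅x⁆ rewrite x∈⁅y⁆⇒x≡y x y∈⁅x⁆ = x∈r

  p⊆q⇒p∪⁅x⁆⊆q∪⁅x⁆ : ∀ {p q : Subset n} {x} → p ⊆ q → p ∪ ⁅ x ⁆ ⊆ q ∪ ⁅ x ⁆
  p⊆q⇒p∪⁅x⁆⊆q∪⁅x⁆ {q = q} {x} p⊆q =
    p∪⁅x⁆⊆r (⊆-trans p⊆q (p⊆p∪q ⁅ x ⁆)) (q⊆p∪q q ⁅ x ⁆ (x∈⁅x⁆ x))

  q⊆r∧p─q⊆r⇒p⊆r : ∀ {p q r : Subset n} → q ⊆ r → p ─ q ⊆ r → p ⊆ r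
  q⊆r∧p─q⊆r⇒p⊆r {q = q} q⊆r p─q⊆r {x} x∈p with x ∈? q
  ... | yes x∈q = q⊆r x∈q
  ... | no x∉q = p─q⊆r (x∈p∧x∉q⇒x∈p─q x∈p x∉q)

  lookup≡false⇒∉ : ∀ {p : Subset n} {x} → lookup p x ≡ false → x ∉ p
  lookup≡false⇒∉ p[x]≡false x∈p with ≡.trans (≡.sym ([]=⇒lookup x∈p)) p[x]≡false
  ... | ()

module _ {n : ℕ} (M : Matroid n) where
  open Matroid M

  Augmentable : Subset n → Subset n → Set
  Augmentable Y I = ∃ λ e → e ∈ Y × e ∉ I × Indep (I ∪ ⁅ e ⁆)

  unaugmentable⇒rank : ∀ {Y I} → I ⊆ Y → Indep I → ¬ Augmentable Y I → HasRank M Y ∣ I ∣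
  unaugmentable⇒rank {Y} {I} I⊆Y indI ¬aug = (I , I⊆Y , indI , ≡.refl) , bound
    where
    bound : ∀ J → J ⊆ Y → Indep J → ∣ J ∣ ≤ ∣ I ∣
    bound J J⊆Y indJ with ∣ J ∣ ≤? ∣ I ∣
    ... | yes ∣J∣≤∣I∣ = ∣J∣≤∣I∣
    ... | no ∣J∣≰∣I∣ =
      let e , e∈J , e∉I , indI∪e = indep-aug indI indJ (≰⇒> ∣J∣≰∣I∣)
      in ⊥-elim (¬aug (e , J⊆Y e∈J , e∉I , indI∪e))

  augmentable-∪⁅⁆ : ∀ {Y I t} → Augmentable (Y ∪ ⁅ t ⁆) I → Augmentable Y I ⊎ Indep (I ∪ ⁅ t ⁆)
  augmentable-∪⁅⁆ {Y} {t = t} (e , e∈Y∪t , e∉I , indI∪e) with x∈p∪q⁻ Y ⁅ t ⁆ e∈Y∪t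
  ... | inj₁ e∈Y = inj₁ (e , e∈Y , e∉I , indI∪e)
  ... | inj₂ e∈⁅t⁆ rewrite x∈⁅y⁆⇒x≡y t e∈⁅t⁆ = inj₂ indI∪e

  flat⇒¬¬augmentable : ∀ {X I t} → IsFlat M X → t ∉ X → I ⊆ X → Indep I →
                       ¬ Indep (I ∪ ⁅ t ⁆) → ¬ ¬ Augmentable X I
  flat⇒¬¬augmentable {X} {I} {t} flat t∉X I⊆X indI dep ¬aug =
    <-irrefl ≡.refl (flat t t∉X ∣ I ∣ ∣ I ∣ rank-X rank-X∪t)
    where
    rank-X : HasRank M X ∣ I ∣
    rank-X = unaugmentable⇒rank I⊆X indI ¬aug
    rank-X∪t : HasRank M (X ∪ ⁅ t ⁆) ∣ I ∣
    rank-X∪t = unaugmentable⇒rank (⊆-trans I⊆X (p⊆p∪q ⁅ t ⁆)) indI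
                                  ([ ¬aug , dep ]′ ∘ augmentable-∪⁅⁆)

  -- Indep is not decidable, so W cannot be extended to a basis of X; the goal being
  -- a negation, we augment W as long as the refutation demands, with fuel k.
  flat⇒¬¬indep-∪⁅⁆ : ∀ {X W t} → IsFlat M X → t ∉ X → W ⊆ X → Indep W → ¬ ¬ Indep (W ∪ ⁅ t ⁆)
  flat⇒¬¬indep-∪⁅⁆ {X} {W} {t} flat t∉X W⊆X indW depW = grow n W (m≤m+n n ∣ W ∣) ⊆-refl W⊆X indW
    where
    grow : ∀ k I → n ≤ k ℕ.+ ∣ I ∣ → W ⊆ I → I ⊆ X → Indep I → ⊥
    grow k I bound W⊆I I⊆X indI =
      flat⇒¬¬augmentable flat t∉X I⊆X indI depI (no-augmentation k bound)
      where
      depI : ¬ Indep (I ∪ ⁅ t ⁆)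
      depI = depW ∘ indep-⊆ (p⊆q⇒p∪⁅x⁆⊆q∪⁅x⁆ W⊆I)
      no-augmentation : ∀ k → n ≤ k ℕ.+ ∣ I ∣ → ¬ Augmentable X I
      no-augmentation zero bound (e , _ , e∉I , _) =
        <⇒≱ (p⊂q⇒∣p∣<∣q∣ (p⊂p∪⁅x⁆ e∉I)) (≤-trans (∣p∣≤n (I ∪ ⁅ e ⁆)) bound)
      no-augmentation (suc k) bound (e , e∈X , e∉I , indI∪e) =
        grow k (I ∪ ⁅ e ⁆)
          (≤-trans bound (≤-trans (≤-reflexive (≡.sym (+-suc k ∣ I ∣)))
                                  (+-monoʳ-≤ k (p⊂q⇒∣p∣<∣q∣ (p⊂p∪⁅x⁆ e∉I)))))
          (⊆-trans W⊆I (p⊆p∪q ⁅ e ⁆)) (p∪⁅x⁆⊆r I⊆X e∈X) indI∪e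

  flat-circuit-≢ : ∀ {X C W t} → IsFlat M X → IsCircuitIn ⊤ Indep C → W ⊆ X → t ∉ X → W ∪ ⁅ t ⁆ ≢ C
  flat-circuit-≢ flat (_ , dependent , minimal) W⊆X t∉X ≡.refl =
    flat⇒¬¬indep-∪⁅⁆ flat t∉X W⊆X (minimal _ (p⊂p∪⁅x⁆ (t∉X ∘ W⊆X))) dependent

  restriction-circuit⇒circuit : ∀ {X C} → IsCircuitIn X (RestrictIndep M X) C →
                                IsCircuitIn ⊤ Indep C
  restriction-circuit⇒circuit (C⊆X , dependent , minimal) =
    ⊆⊤ , (λ indC → dependent (C⊆X , indC)) , (λ D D⊂C → proj₂ (minimal D D⊂C))

  circuit⇒restriction-circuit : ∀ {X C} → IsCircuitIn ⊤ Indep C → C ⊆ X →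
                                IsCircuitIn X (RestrictIndep M X) C
  circuit⇒restriction-circuit (_ , dependent , minimal) C⊆X =
    C⊆X , dependent ∘ proj₂ , (λ D D⊂C → ⊆-trans (proj₁ D⊂C) C⊆X , minimal D D⊂C)

module _ {c ℓ} (F : Field c ℓ) (n : ℕ) where
  open Exterior F n
  open Field F

  sumK-cong : ∀ {a} {A : Set a} {f g : A → Carrier} (l : List A) →
              (∀ z → f z ≈ g z) → sumK (map f l) ≈ sumK (map g l)
  sumK-cong [] f≈g = refl
  sumK-cong (z ∷ l) f≈g = +-cong (f≈g z) (sumK-cong l f≈g)

  sumK-zero : ∀ {a} {A : Set a} {f : A → Carrier} (l : List A) →
              (∀ z → f z ≈ 0#) → sumK (map f l) ≈ 0#
  sumK-zero [] f≈0 = refl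
  sumK-zero (z ∷ l) f≈0 = trans (+-cong (f≈0 z) (sumK-zero l f≈0)) (+-identityˡ 0#)

  sumΛ-zero : ∀ {a} {A : Set a} {f : A → Λ} (l : List A) T →
              (∀ z → f z T ≈ 0#) → sumΛ (map f l) T ≈ 0#
  sumΛ-zero [] T f≈0 = refl
  sumΛ-zero (z ∷ l) T f≈0 = trans (+-cong (f≈0 z) (sumΛ-zero l T f≈0)) (+-identityˡ 0#)

  ∧-summand : Λ → Λ → Subset n → Subset n → Carrier
  ∧-summand x y W T = if does (T ⊆? W) then sgn (inv T (W ─ T)) * (x T * y (W ─ T)) else 0#

  ∧-coeff-cong : ∀ x x' y y' W → (∀ T → T ⊆ W → x T ≈ x' T) →
                 (∀ T → T ⊆ W → y (W ─ T) ≈ y' (W ─ T)) → (x ∧Λ y) W ≈ (x' ∧Λ y') W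
  ∧-coeff-cong x x' y y' W x≈x' y≈y' = sumK-cong (subsets n) summand-cong
    where
    summand-cong : ∀ T → ∧-summand x y W T ≈ ∧-summand x' y' W T
    summand-cong T with T ⊆? W
    ... | yes T⊆W = *-congˡ (*-cong (x≈x' T T⊆W) (y≈y' T T⊆W))
    ... | no _ = refl

  ∧-coeff-zero : ∀ x y W → (∀ T → T ⊆ W → x T ≈ 0# ⊎ y (W ─ T) ≈ 0#) → (x ∧Λ y) W ≈ 0#
  ∧-coeff-zero x y W x≈0⊎y≈0 = sumK-zero (subsets n) summand-zero
    where
    summand-zero : ∀ T → ∧-summand x y W T ≈ 0#
    summand-zero T with T ⊆? W
    ... | no _ = refl
    ... | yes T⊆W with x≈0⊎y≈0 T T⊆W
    ...   | inj₁ x≈0 = trans (*-congˡ (trans (*-congʳ x≈0) (zeroˡ _))) (zeroʳ _)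
    ...   | inj₂ y≈0 = trans (*-congˡ (trans (*-congˡ y≈0) (zeroʳ _))) (zeroʳ _)

  ∧-cong : ∀ {x x' y y'} → x ≋ x' → y ≋ y' → x ∧Λ y ≋ x' ∧Λ y'
  ∧-cong {x} {x'} {y} {y'} x≋x' y≋y' W =
    ∧-coeff-cong x x' y y' W (λ T _ → x≋x' T) (λ T _ → y≋y' (W ─ T))

  ∧-zeroˡ : ∀ {x} y → x ≋ 0Λ → x ∧Λ y ≋ 0Λ
  ∧-zeroˡ {x} y x≋0 W = ∧-coeff-zero x y W (λ T _ → inj₁ (x≋0 T))

  ∧-zeroʳ : ∀ x {y} → y ≋ 0Λ → x ∧Λ y ≋ 0Λ
  ∧-zeroʳ x {y} y≋0 W = ∧-coeff-zero x y W (λ T _ → inj₂ (y≋0 (W ─ T)))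

  e-off-diagonal : ∀ {T U} → U ≢ T → e T U ≈ 0#
  e-off-diagonal {T} {U} U≢T with ≡-dec B._≟_ U T
  ... | yes U≡T = ⊥-elim (U≢T U≡T)
  ... | no _ = refl

  ∂-coeff-zero : ∀ x W → (∀ t → t ∉ W → x (W ∪ ⁅ t ⁆) ≈ 0#) → ∂ x W ≈ 0#
  ∂-coeff-zero x W x≈0 = sumK-zero (allFin n) (λ t → unless-zero (mem W t) (x≈0 t ∘ lookup≡false⇒∉))
    where
    unless-zero : ∀ b {s y} → (b ≡ false → y ≈ 0#) → (if b then 0# else s * y) ≈ 0#
    unless-zero true _ = refl
    unless-zero false y≈0 = trans (*-congˡ (y≈0 ≡.refl)) (zeroʳ _)

  ∂e-coeff-zero : ∀ C W → (∀ t → t ∉ W → W ∪ ⁅ t ⁆ ≢ C) → ∂ (e C) W ≈ 0#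
  ∂e-coeff-zero C W W∪t≢C = ∂-coeff-zero (e C) W (λ t t∉W → e-off-diagonal (W∪t≢C t t∉W))

  ∂e-supported : ∀ {X C} → C ⊆ X → SupportedIn X (∂ (e C))
  ∂e-supported C⊆X W W⊈X = ∂e-coeff-zero _ W λ { t _ ≡.refl → W⊈X (C⊆X ∘ p⊆p∪q _) }

  embedV-supported : ∀ {X} v → (∀ i → i ∉ X → v i ≈ 0#) → SupportedIn X (embedV v)
  embedV-supported {X} v v≈0 T T⊈X = sumΛ-zero (allFin n) T term-zero
    where
    term-zero : ∀ i → v i * e ⁅ i ⁆ T ≈ 0#
    term-zero i with i ∈? X
    ... | no i∉X = trans (*-congʳ (v≈0 i i∉X)) (zeroˡ _)
    ... | yes i∈X = trans (*-congˡ (e-off-diagonal {⁅ i ⁆} {T} T≢⁅i⁆)) (zeroʳ _)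
      where
      T≢⁅i⁆ : T ≢ ⁅ i ⁆
      T≢⁅i⁆ ≡.refl = T⊈X λ j∈⁅i⁆ → ≡.subst (_∈ X) (≡.sym (x∈⁅y⁆⇒x≡y i j∈⁅i⁆)) i∈X

  SupportedIn-mono : ∀ {G G'} → G ⊆ G' → ∀ {x} → SupportedIn G x → SupportedIn G' x
  SupportedIn-mono G⊆G' x∈G T T⊈G' = x∈G T λ T⊆G → T⊈G' (⊆-trans T⊆G G⊆G')

  IsGeneratorIn : Subset n → (Subset n → Set) → Λ × Subset n × Λ → Set ℓ
  IsGeneratorIn G Ind (a , C , b) = SupportedIn G a × SupportedIn G b × IsCircuitIn G Ind C

  generator : Λ × Subset n × Λ → Λ
  generator (a , C , b) = a ∧Λ ∂ (e C) ∧Λ b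

  InIdeal-≋0 : ∀ {G Ind x} → x ≋ 0Λ → InIdeal G Ind x
  InIdeal-≋0 x≋0 = [] , [] , x≋0

  InIdeal-resp-≋ : ∀ {G Ind x y} → x ≋ y → InIdeal G Ind y → InIdeal G Ind x
  InIdeal-resp-≋ x≋y (gs , gens , y≋) = gs , gens , λ T → trans (x≋y T) (y≋ T)

  InIdeal-generator-+ : ∀ {G Ind} a C b {x} →
                        SupportedIn G a → SupportedIn G b → IsCircuitIn G Ind C →
                        InIdeal G Ind x → InIdeal G Ind (a ∧Λ ∂ (e C) ∧Λ b +Λ x)
  InIdeal-generator-+ a C b a∈G b∈G circuit (gs , gens , x≋) =
    (a , C , b) ∷ gs , (a∈G , b∈G , circuit) ∷ gens , λ T → +-congˡ (x≋ T)

  InIdeal-mono : ∀ {G G' Ind Ind'} → G ⊆ G' →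
                 (∀ {C} → IsCircuitIn G Ind C → IsCircuitIn G' Ind' C) →
                 ∀ {x} → InIdeal G Ind x → InIdeal G' Ind' x
  InIdeal-mono {G} {G'} {Ind} {Ind'} G⊆G' circuit⇒circuit (gs , gens , x≋) =
    gs , All.map generator-mono gens , x≋
    where
    generator-mono : ∀ {g} → IsGeneratorIn G Ind g → IsGeneratorIn G' Ind' g
    generator-mono (a∈G , b∈G , circuit) =
      SupportedIn-mono G⊆G' a∈G , SupportedIn-mono G⊆G' b∈G , circuit⇒circuit circuit

  ≋⇒≈A : ∀ {G Ind x y} → x ≋ y → ≈A[ G , Ind ] x y
  ≋⇒≈A {y = y} x≋y = InIdeal-≋0 λ T → trans (+-congʳ (x≋y T)) (-‿inverseʳ (y T))

  ≈A-resp-≋ : ∀ {G Ind x x' y y'} → x ≋ x' → y ≋ y' → ≈A[ G , Ind ] x' y' → ≈A[ G , Ind ] x y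
  ≈A-resp-≋ x≋x' y≋y' = InIdeal-resp-≋ λ T → +-cong (x≋x' T) (-‿cong (y≋y' T))

module _ {c ℓ} (F : Field c ℓ) {n : ℕ} (X : Subset n) where
  open Exterior F n
  open Field F

  restrict : Λ → Λ
  restrict x T = if does (T ⊆? X) then x T else 0#

  restrict-inside : ∀ x {T} → T ⊆ X → restrict x T ≈ x T
  restrict-inside x {T} T⊆X with T ⊆? X
  ... | yes _ = refl
  ... | no T⊈X = ⊥-elim (T⊈X T⊆X)

  restrict-supported : ∀ x → SupportedIn X (restrict x)
  restrict-supported x T T⊈X with T ⊆? X
  ... | yes T⊆X = ⊥-elim (T⊈X T⊆X)
  ... | no _ = refl

  restrict-id : ∀ {y} → SupportedIn X y → restrict y ≋ y
  restrict-id y∈X T with T ⊆? X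
  ... | yes _ = refl
  ... | no T⊈X = sym (y∈X T T⊈X)

  restrict-cong : ∀ {x y} → x ≋ y → restrict x ≋ restrict y
  restrict-cong x≋y T with T ⊆? X
  ... | yes _ = x≋y T
  ... | no _ = refl

  restrict-+ : ∀ x y → restrict (x +Λ y) ≋ restrict x +Λ restrict y
  restrict-+ x y T with T ⊆? X
  ... | yes _ = refl
  ... | no _ = sym (+-identityˡ 0#)

  restrict-- : ∀ x y → restrict (x -Λ y) ≋ restrict x -Λ restrict y
  restrict-- x y T with T ⊆? X
  ... | yes _ = refl
  ... | no _ = sym (-‿inverseʳ 0#)

  restrict-• : ∀ a x → restrict (a • x) ≋ a • restrict x
  restrict-• a x T with T ⊆? X
  ... | yes _ = refl
  ... | no _ = sym (zeroʳ a)

  restrict-proj : ∀ p x → restrict (proj p x) ≋ proj p (restrict x)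
  restrict-proj p x T with T ⊆? X | ∣ T ∣ ℕ.≡ᵇ p
  ... | yes _ | true = refl
  ... | yes _ | false = refl
  ... | no _ | true = refl
  ... | no _ | false = refl

  -- W ⊆ X exactly when both T and W ─ T are, for every T ⊆ W.
  restrict-∧ : ∀ x y → restrict (x ∧Λ y) ≋ restrict x ∧Λ restrict y
  restrict-∧ x y W with W ⊆? X
  ... | yes W⊆X = ∧-coeff-cong F n x (restrict x) y (restrict y) W
                    (λ T T⊆W → sym (restrict-inside x (⊆-trans T⊆W W⊆X)))
                    (λ T _ → sym (restrict-inside y (⊆-trans (p─q⊆p W T) W⊆X)))
  ... | no W⊈X = sym (∧-coeff-zero F n (restrict x) (restrict y) W restricted-factor-zero)
    where
    restricted-factor-zero : ∀ T → T ⊆ W → restrict x T ≈ 0# ⊎ restrict y (W ─ T) ≈ 0#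
    restricted-factor-zero T _ with T ⊆? X | (W ─ T) ⊆? X
    ... | no _ | _ = inj₁ refl
    ... | yes _ | no _ = inj₂ refl
    ... | yes T⊆X | yes W─T⊆X = ⊥-elim (W⊈X (q⊆r∧p─q⊆r⇒p⊆r T⊆X W─T⊆X))

  restrict-∧-supportedʳ : ∀ x {y} → SupportedIn X y → restrict (x ∧Λ y) ≋ restrict x ∧Λ y
  restrict-∧-supportedʳ x {y} y∈X T =
    trans (restrict-∧ x y T) (∧-cong F n {x = restrict x} (λ _ → refl) (restrict-id y∈X) T)

  restrict-generator : ∀ a z b → restrict (a ∧Λ z ∧Λ b) ≋ restrict a ∧Λ restrict z ∧Λ restrict b
  restrict-generator a z b T =
    trans (restrict-∧ (a ∧Λ z) b T) (∧-cong F n {y = restrict b} (restrict-∧ a z) (λ _ → refl) T)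

module _ {c ℓ} (F : Field c ℓ) {n : ℕ} (M : Matroid n) {X : Subset n} (flat : IsFlat M X) where
  open Exterior F n
  open Field F
  open Matroid M

  restrict-∂e-circuit : ∀ {C} → IsCircuitIn ⊤ Indep C → ¬ C ⊆ X → restrict F X (∂ (e C)) ≋ 0Λ
  restrict-∂e-circuit {C} circuit C⊈X W with W ⊆? X
  ... | no _ = refl
  ... | yes W⊆X = ∂e-coeff-zero F n C W W∪t≢C
    where
    W∪t≢C : ∀ t → t ∉ W → W ∪ ⁅ t ⁆ ≢ C
    W∪t≢C t _ W∪t≡C with t ∈? X
    ... | no t∉X = flat-circuit-≢ M flat circuit W⊆X t∉X W∪t≡C
    ... | yes t∈X = C⊈X (≡.subst (_⊆ X) W∪t≡C (p∪⁅x⁆⊆r W⊆X t∈X))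

  restrict-generator-⊆ : ∀ a {C} b → C ⊆ X →
                         restrict F X (generator F n (a , C , b))
                           ≋ generator F n (restrict F X a , C , restrict F X b)
  restrict-generator-⊆ a {C} b C⊆X T =
    trans (restrict-generator F X a (∂ (e C)) b T)
          (∧-cong F n {y = restrict F X b}
                  (∧-cong F n {x = restrict F X a} (λ _ → refl)
                          (restrict-id F X (∂e-supported F n C⊆X)))
                  (λ _ → refl) T)

  restrict-generator-⊈ : ∀ a {C} b → IsCircuitIn ⊤ Indep C → ¬ C ⊆ X →
                         restrict F X (generator F n (a , C , b)) ≋ 0Λ
  restrict-generator-⊈ a {C} b circuit C⊈X T =
    trans (restrict-generator F X a (∂ (e C)) b T)
          (∧-zeroˡ F n (restrict F X b)
                   (∧-zeroʳ F n (restrict F X a) (restrict-∂e-circuit circuit C⊈X)) T)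

  restrict-InIdeal : ∀ {x} → InIdeal ⊤ Indep x → InIdeal X (RestrictIndep M X) (restrict F X x)
  restrict-InIdeal (gs , gens , x≋) =
    InIdeal-resp-≋ F n (restrict-cong F X x≋) (restrict-sum gs gens)
    where
    restrict-sum : ∀ gs → All (IsGeneratorIn F n ⊤ Indep) gs →
                   InIdeal X (RestrictIndep M X) (restrict F X (sumΛ (map (generator F n) gs)))
    restrict-sum [] [] = InIdeal-≋0 F n (restrict-id F X λ _ _ → refl)
    restrict-sum (g@(a , C , b) ∷ gs) ((_ , _ , circuit) ∷ gens) with C ⊆? X
    ... | yes C⊆X =
      InIdeal-resp-≋ F n
        (λ T → trans (restrict-+ F X (generator F n g) (sumΛ (map (generator F n) gs)) T)
                     (+-congʳ (restrict-generator-⊆ a b C⊆X T)))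
        (InIdeal-generator-+ F n (restrict F X a) C (restrict F X b)
          (restrict-supported F X a) (restrict-supported F X b)
          (circuit⇒restriction-circuit M circuit C⊆X) (restrict-sum gs gens))
    ... | no C⊈X =
      InIdeal-resp-≋ F n
        (λ T → trans (restrict-+ F X (generator F n g) (sumΛ (map (generator F n) gs)) T)
                     (trans (+-congʳ (restrict-generator-⊈ a b circuit C⊈X T)) (+-identityˡ _)))
        (restrict-sum gs gens)

  restrict-≈A : ∀ x y → ≈A[ ⊤ , Indep ] x y →
                ≈A[ X , RestrictIndep M X ] (restrict F X x) (restrict F X y)
  restrict-≈A x y x∼y = InIdeal-resp-≋ F n (λ T → sym (restrict-- F X x y T)) (restrict-InIdeal x∼y)

  supported-≈A⇒restriction-≈A : ∀ x y → SupportedIn X x → SupportedIn X y →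
                                ≈A[ ⊤ , Indep ] x y → ≈A[ X , RestrictIndep M X ] x y
  supported-≈A⇒restriction-≈A x y x∈X y∈X x∼y =
    ≈A-resp-≋ F n (λ T → sym (restrict-id F X x∈X T)) (λ T → sym (restrict-id F X y∈X T))
                  (restrict-≈A x y x∼y)

proposition4p1 :
  ∀ {c ℓ} (F : Field c ℓ) (n : ℕ) (M : Matroid n) (X : Subset n) → IsFlat M X →
  (v : Fin n → Field.Carrier F) → (∀ i → i ∉ X → Field._≈_ F (v i) (Field.0# F)) →
  let open Exterior F n
      open Field F
      _∼M_ = ≈A[ ⊤ , Matroid.Indep M ]
      _∼X_ = ≈A[ X , RestrictIndep M X ]
      V = embedV v
  in
  (∀ x y → SupportedIn X x → SupportedIn X y → x ∼X y → x ∼M y)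
  × (∀ x y → SupportedIn X x → SupportedIn X y → x ∼M y → x ∼X y)
  × Σ (Λ → Λ) λ π →
      (∀ x → SupportedIn X (π x))
    × (∀ x y → x ∼M y → π x ∼X π y)
    × (∀ x y → π (x +Λ y) ∼X (π x +Λ π y))
    × (∀ a x → π (a • x) ∼X (a • π x))
    × (∀ p x → π (proj p x) ∼X proj p (π x))
    × (∀ x → π (x ∧Λ V) ∼X (π x ∧Λ V))
    × (∀ y → SupportedIn X y → π y ∼X y)
proposition4p1 F n M X flat v v∈X =
    (λ _ _ _ _ → InIdeal-mono F n ⊆⊤ (restriction-circuit⇒circuit M))
  , supported-≈A⇒restriction-≈A F M flat
  , restrict F X
  , restrict-supported F X
  , restrict-≈A F M flat
  , (λ x y → ≋⇒≈A F n (restrict-+ F X x y))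
  , (λ a x → ≋⇒≈A F n (restrict-• F X a x))
  , (λ p x → ≋⇒≈A F n (restrict-proj F X p x))
  , (λ x → ≋⇒≈A F n (restrict-∧-supportedʳ F X x (embedV-supported F n v v∈X)))
  , (λ y y∈X → ≋⇒≈A F n (restrict-id F X y∈X))
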